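{- Let $C>0$, let $G=(V,E)$ be a graph on $n$ vertices belonging to $\mathcal{G}_C$, let $\epsilon>0$, and let $\tilde V=\{v\in V:\deg(v)\geq \epsilon n\}$. Then \[ |\tilde V|\leq \frac{2C}{\epsilon}\qquad\text{and}\qquad \sum_{\{u,v\}\in\binom{\tilde V}{2}}\deg(u,v)\leq n+4\Bigl(\frac{C}{\epsilon}\Bigr)^4. \]
   Context: For $C>0$, $\mathcal{G}_C$ is the class of graphs containing no copy of $K_{3,3}$ and in which every subgraph $H$ satisfies $|E(H)|\leq C|V(H)|$. $\deg(u,v)=|N(u)\cap N(v)|$ is the co-degree of $u$ and $v$.
   Formalization: The parameters C and ε range over the positive rationals. -}

module Defs where

open import Data.Bool using (Bool; true; false; _∧_; if_then_else_)
open import Data.Nat as ℕ using (ℕ; zero; suc)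
open import Data.Fin using (Fin; toℕ)
open import Data.List using (List; map; allFin)
open import Data.Nat.ListAction using (sum)
open import Data.Product using (Σ; _×_; _,_)
open import Data.Sum using (_⊎_; inj₁; inj₂)
open import Data.Integer using (+_)
open import Data.Rational using (ℚ; _/_; _≤_; _*_; _+_; 0ℚ; _<_; _÷_; >-nonZero)
open import Function.Definitions using (Injective)
open import Relation.Binary.PropositionalEquality using (_≡_)
open import Relation.Nullary using (¬_)

ℕ→ℚ : ℕ → ℚ
ℕ→ℚ n = + n / 1

b2n : Bool → ℕ
b2n true  = 1
b2n false = 0

Σ[_] : (n : ℕ) → (Fin n → ℕ) → ℕ
Σ[ n ] f = sum (map f (allFin n))

record Graph (n : ℕ) : Set where
  field
    adj   : Fin n → Fin n → Bool
    sym   : ∀ i j → adj i j ≡ adj j i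
    irrefl : ∀ i → adj i i ≡ false
open Graph public

deg : ∀ {n} → Graph n → Fin n → ℕ
deg G v = Σ[ _ ] (λ w → b2n (adj G v w))

-- co-degree deg(u,v) = |N(u) ∩ N(v)|
codeg : ∀ {n} → Graph n → Fin n → Fin n → ℕ
codeg G u v = Σ[ _ ] (λ w → b2n (adj G u w ∧ adj G v w))

record Subgraph {n : ℕ} (G : Graph n) : Set where
  field
    vert  : Fin n → Bool
    eadj  : Fin n → Fin n → Bool
    esym  : ∀ i j → eadj i j ≡ eadj j i
    eirr  : ∀ i → eadj i i ≡ false
    sub   : ∀ i j → eadj i j ≡ true →
            (adj G i j ≡ true) × (vert i ≡ true) × (vert j ≡ true)
open Subgraph public

vcount : ∀ {n} {G : Graph n} → Subgraph G → ℕ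
vcount H = Σ[ _ ] (λ i → b2n (vert H i))

ecount : ∀ {n} {G : Graph n} → Subgraph G → ℕ
ecount {n} H = Σ[ n ] (λ i → Σ[ n ] (λ j →
  if toℕ i ℕ.<ᵇ toℕ j then b2n (eadj H i j) else 0))

ContainsK33 : ∀ {n} → Graph n → Set
ContainsK33 {n} G = Σ (Fin 3 ⊎ Fin 3 → Fin n) λ f →
  Injective _≡_ _≡_ f × (∀ i j → adj G (f (inj₁ i)) (f (inj₂ j)) ≡ true)

InClass : ∀ {n} → ℚ → Graph n → Set
InClass C G = ¬ ContainsK33 G ×
  (∀ (H : Subgraph G) → ℕ→ℚ (ecount H) ≤ C * ℕ→ℚ (vcount H))

open import Relation.Nullary.Decidable using (⌊_⌋)
open import Data.Rational.Properties using (_≤?_)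

inṼ : ∀ {n} → Graph n → ℚ → Fin n → Bool
inṼ {n} G ε v = ⌊ ε * ℕ→ℚ n ≤? ℕ→ℚ (deg G v) ⌋

Ṽsize : ∀ {n} → Graph n → ℚ → ℕ
Ṽsize G ε = Σ[ _ ] (λ v → b2n (inṼ G ε v))

ṼpairCodegSum : ∀ {n} → Graph n → ℚ → ℕ
ṼpairCodegSum {n} G ε = Σ[ n ] (λ u → Σ[ n ] (λ v →
  if (toℕ u ℕ.<ᵇ toℕ v) ∧ inṼ G ε u ∧ inṼ G ε v then codeg G u v else 0))

_^4 : ℚ → ℚ
x ^4 = x * x * x * x

-- Every vertex of Ṽ has degree at least εn, and the degrees sum to 2|E(G)| ≤ 2Cn, so |Ṽ|·εn ≤ 2Cn.
-- For the codegree sum, count each pair {u,v} ⊆ Ṽ once for every common neighbour w: writing d_w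
-- for the number of neighbours of w in Ṽ, the sum is Σ_w C(d_w,2) ≤ Σ_w (1 + 2 C(d_w,3)).
-- Counting triples in the same way, Σ_w C(d_w,3) = Σ_{T ∈ C(Ṽ,3)} |common neighbourhood of T|, and
-- since G has no K_{3,3} every triple has at most two common neighbours. Hence
-- Σ_w C(d_w,3) ≤ 2 C(|Ṽ|,3) ≤ |Ṽ|⁴/8 ≤ 2 (C/ε)⁴.

module Submission where

open import Defs hiding (sym)
open import Data.Bool using (Bool; true; false; _∧_; if_then_else_; T)
open import Data.Fin using (Fin; toℕ; zero; suc)
open import Data.Product using (Σ-syntax; _×_; _,_; proj₁; proj₂)
open import Function using (_∘_)
open import Relation.Binary.PropositionalEquality
open import Relation.Nullary using (¬_)
open import Data.Nat.Properties using (+-*-semiring)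
open import Algebra.Properties.Semiring.Sum +-*-semiring using (sum; sum-syntax)

module Combinatorics where
  open import Data.Nat as ℕ using (ℕ; zero; suc; _+_; _*_; _≤_; _<_; z≤n; s≤s; s≤s⁻¹; _<ᵇ_)
  open import Data.Nat.Properties
  open import Data.Nat.Combinatorics using (_C_; nC1≡n; nCk+nC[k+1]≡[n+1]C[k+1])
  open import Data.Nat.Tactic.RingSolver using (solve)
  open import Data.Nat.ListAction using () renaming (sum to sumList)
  import Data.List as List
  import Data.List.Properties as List
  open import Data.List using (_∷_; [])
  open import Data.Bool.Properties using (∧-zeroʳ; ∧-conicalˡ; ∧-conicalʳ; ∧-commutativeMonoid)
  open import Algebra.Solver.CommutativeMonoid ∧-commutativeMonoid as ∧-Solver using (_⊕_; _⊜_)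
  open import Algebra.Properties.Semiring.Sum +-*-semiring
    using (sum-cong-≗; ∑-comm; ∑-distrib-+; *-distribˡ-sum; sum-replicate-zero)
  import Data.Fin.Properties as Fin
  open import Data.Fin.Patterns using (0F; 1F; 2F)
  open import Data.Sum using (_⊎_; inj₁; inj₂)
  open import Data.Empty using (⊥-elim)
  open import Data.Unit using (tt)
  open import Function using (id)
  open import Function.Definitions using (Injective)
  open import Relation.Nullary using (yes; no; ofʸ; ofⁿ)

  -- Finite sums over Fin n

  Σ≡sum : ∀ {n} (f : Fin n → ℕ) → Σ[ n ] f ≡ sum f
  Σ≡sum {zero}  f = refl
  Σ≡sum {suc n} f = cong (f zero +_) (begin
    sumList (List.map f (List.tabulate suc))  ≡⟨ cong sumList (List.map-tabulate suc f) ⟩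
    sumList (List.tabulate (f ∘ suc))          ≡⟨ cong sumList (List.map-tabulate id (f ∘ suc)) ⟨
    Σ[ n ] (f ∘ suc)                           ≡⟨ Σ≡sum (f ∘ suc) ⟩
    sum (f ∘ suc)                              ∎)
    where open ≡-Reasoning

  sum-ones : ∀ n → ∑[ i < n ] 1 ≡ n
  sum-ones zero    = refl
  sum-ones (suc n) = cong suc (sum-ones n)

  sum-mono-≤ : ∀ {n} {f g : Fin n → ℕ} → (∀ i → f i ≤ g i) → sum f ≤ sum g
  sum-mono-≤ {zero}  f≤g = z≤n
  sum-mono-≤ {suc n} f≤g = +-mono-≤ (f≤g zero) (sum-mono-≤ (f≤g ∘ suc))

  -- Binomial coefficients

  [1+n]C2≡n+nC2 : ∀ n → suc n C 2 ≡ n + n C 2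
  [1+n]C2≡n+nC2 n = begin
    suc n C 2      ≡⟨ nCk+nC[k+1]≡[n+1]C[k+1] n 1 ⟨
    n C 1 + n C 2  ≡⟨ cong (_+ n C 2) (nC1≡n n) ⟩
    n + n C 2      ∎
    where open ≡-Reasoning

  [1+n]C3≡nC2+nC3 : ∀ n → suc n C 3 ≡ n C 2 + n C 3
  [1+n]C3≡nC2+nC3 n = sym (nCk+nC[k+1]≡[n+1]C[k+1] n 2)

  2*nC2≤n*n : ∀ n → 2 * (n C 2) ≤ n * n
  2*nC2≤n*n zero    = z≤n
  2*nC2≤n*n (suc n) = begin
    2 * (suc n C 2)      ≡⟨ cong (2 *_) ([1+n]C2≡n+nC2 n) ⟩
    2 * (n + n C 2)      ≡⟨ *-distribˡ-+ 2 n (n C 2) ⟩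
    2 * n + 2 * (n C 2)  ≤⟨ +-monoʳ-≤ (2 * n) (2*nC2≤n*n n) ⟩
    2 * n + n * n        <⟨ n<1+n _ ⟩
    suc (2 * n + n * n)  ≡⟨ solve (n ∷ []) ⟩
    suc n * suc n        ∎
    where open ≤-Reasoning

  6*nC3≤n*n*n : ∀ n → 6 * (n C 3) ≤ n * n * n
  6*nC3≤n*n*n zero    = z≤n
  6*nC3≤n*n*n (suc n) = begin
    6 * (suc n C 3)                        ≡⟨ cong (6 *_) ([1+n]C3≡nC2+nC3 n) ⟩
    6 * (n C 2 + n C 3)                    ≡⟨ *-distribˡ-+ 6 (n C 2) (n C 3) ⟩
    6 * (n C 2) + 6 * (n C 3)              ≡⟨ cong (_+ 6 * (n C 3)) (*-assoc 3 2 (n C 2)) ⟩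
    3 * (2 * (n C 2)) + 6 * (n C 3)        ≤⟨ +-mono-≤ (*-monoʳ-≤ 3 (2*nC2≤n*n n)) (6*nC3≤n*n*n n) ⟩
    3 * (n * n) + n * n * n                ≤⟨ m≤n+m _ (1 + 3 * n) ⟩
    1 + 3 * n + (3 * (n * n) + n * n * n)  ≡⟨ solve (n ∷ []) ⟩
    suc n * suc n * suc n                  ∎
    where open ≤-Reasoning

  16*nC3≤n*n*n*n : ∀ n → 16 * (n C 3) ≤ n * n * n * n
  16*nC3≤n*n*n*n 0 = z≤n
  16*nC3≤n*n*n*n 1 = z≤n
  16*nC3≤n*n*n*n 2 = z≤n
  16*nC3≤n*n*n*n n@(suc (suc (suc m))) = begin
    16 * (n C 3)       ≤⟨ *-monoˡ-≤ (n C 3) (m≤m+n 16 2) ⟩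
    18 * (n C 3)       ≡⟨ *-assoc 3 6 (n C 3) ⟩
    3 * (6 * (n C 3))  ≤⟨ *-monoʳ-≤ 3 (6*nC3≤n*n*n n) ⟩
    3 * (n * n * n)    ≤⟨ *-monoˡ-≤ (n * n * n) (s≤s (s≤s (s≤s (z≤n {m})))) ⟩
    n * (n * n * n)    ≡⟨ *-comm n _ ⟩
    n * n * n * n      ∎
    where open ≤-Reasoning

  n≤1+nC2 : ∀ n → n ≤ 1 + n C 2
  n≤1+nC2 zero    = z≤n
  n≤1+nC2 (suc n) = s≤s (subst (n ≤_) (sym ([1+n]C2≡n+nC2 n)) (m≤m+n n (n C 2)))

  nC2≤1+2*nC3 : ∀ n → n C 2 ≤ 1 + 2 * (n C 3)
  nC2≤1+2*nC3 zero    = z≤n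
  nC2≤1+2*nC3 (suc n) = begin
    suc n C 2                ≡⟨ [1+n]C2≡n+nC2 n ⟩
    n + n C 2                ≤⟨ +-monoˡ-≤ (n C 2) (n≤1+nC2 n) ⟩
    1 + n C 2 + n C 2        ≡⟨ cong (λ m → 1 + n C 2 + m) (+-identityʳ (n C 2)) ⟨
    1 + 2 * (n C 2)          ≤⟨ +-monoʳ-≤ 1 (*-monoʳ-≤ 2 (m≤m+n (n C 2) (n C 3))) ⟩
    1 + 2 * (n C 2 + n C 3)  ≡⟨ cong (λ m → 1 + 2 * m) ([1+n]C3≡nC2+nC3 n) ⟨
    1 + 2 * (suc n C 3)      ∎
    where open ≤-Reasoning

  -- Counting increasing pairs and triples in a subset of Fin n

  _<ᶠ_ : ∀ {n} → Fin n → Fin n → Bool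
  u <ᶠ v = toℕ u <ᵇ toℕ v

  <ᶠ⇒< : ∀ {n} {u v : Fin n} → u <ᶠ v ≡ true → toℕ u < toℕ v
  <ᶠ⇒< {u = u} {v} e = <ᵇ⇒< (toℕ u) (toℕ v) (subst T (sym e) tt)

  count : ∀ {n} → (Fin n → Bool) → ℕ
  count {n} b = ∑[ i < n ] b2n (b i)

  count-∧ˡ : ∀ {n} x (b : Fin n → Bool) → count (λ i → x ∧ b i) ≡ b2n x * count b
  count-∧ˡ {n} false b = sum-replicate-zero n
  count-∧ˡ     true  b = sym (+-identityʳ (count b))

  ≤count⇒injection : ∀ {n k} (b : Fin n → Bool) → k ≤ count b →
                     Σ[ f ∈ (Fin k → Fin n) ] Injective _≡_ _≡_ f × (∀ i → b (f i) ≡ true)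
  ≤count⇒injection {k = zero}  b _ = (λ ()) , (λ { {()} }) , (λ ())
  ≤count⇒injection {zero} {suc k} b ()
  ≤count⇒injection {suc n} {suc k} b k<count with b zero in b₀
  ... | true  = f , f-injective , λ { zero → b₀ ; (suc i) → proj₂ (proj₂ r) i }
    where
    r = ≤count⇒injection (b ∘ suc) (s≤s⁻¹ k<count)
    f : Fin (suc k) → Fin (suc n)
    f zero    = zero
    f (suc i) = suc (proj₁ r i)
    f-injective : Injective _≡_ _≡_ f
    f-injective {zero}  {zero}  _ = refl
    f-injective {suc i} {suc j} p = cong suc (proj₁ (proj₂ r) (Fin.suc-injective p))
  ... | false = suc ∘ proj₁ r , proj₁ (proj₂ r) ∘ Fin.suc-injective , proj₂ (proj₂ r)
    where r = ≤count⇒injection (b ∘ suc) k<count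

  chain₂ : ∀ {n} → (Fin n → Bool) → Fin n → Fin n → Bool
  chain₂ b u v = u <ᶠ v ∧ b u ∧ b v

  chain₃ : ∀ {n} → (Fin n → Bool) → Fin n → Fin n → Fin n → Bool
  chain₃ b u v x = u <ᶠ v ∧ v <ᶠ x ∧ b u ∧ b v ∧ b x

  pairs : ∀ {n} → (Fin n → Bool) → ℕ
  pairs {n} b = ∑[ u < n ] ∑[ v < n ] b2n (chain₂ b u v)

  triples : ∀ {n} → (Fin n → Bool) → ℕ
  triples {n} b = ∑[ u < n ] ∑[ v < n ] ∑[ x < n ] b2n (chain₃ b u v x)

  [b+m]C[1+k]≡b*mCk+mC[1+k] : ∀ x m k → (b2n x + m) C suc k ≡ b2n x * (m C k) + m C suc k
  [b+m]C[1+k]≡b*mCk+mC[1+k] false m k = refl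
  [b+m]C[1+k]≡b*mCk+mC[1+k] true  m k = begin
    suc m C suc k            ≡⟨ nCk+nC[k+1]≡[n+1]C[k+1] m k ⟨
    m C k + m C suc k        ≡⟨ cong (_+ m C suc k) (+-identityʳ (m C k)) ⟨
    1 * (m C k) + m C suc k  ∎
    where open ≡-Reasoning

  pairs-suc : ∀ {n} (b : Fin (suc n) → Bool) →
              pairs b ≡ b2n (b zero) * count (b ∘ suc) + pairs (b ∘ suc)
  pairs-suc b = cong (_+ pairs (b ∘ suc)) (count-∧ˡ (b zero) (b ∘ suc))

  triples-suc : ∀ {n} (b : Fin (suc n) → Bool) →
                triples b ≡ b2n (b zero) * pairs (b ∘ suc) + triples (b ∘ suc)
  triples-suc {n} b = cong₂ _+_ firstRow (sum-cong-≗ laterRow)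
    where
    b₀ = b zero
    firstRow : ∑[ v < suc n ] ∑[ x < suc n ] b2n (chain₃ b zero v x) ≡ b2n b₀ * pairs (b ∘ suc)
    firstRow = begin
      ∑[ x < suc n ] 0 + ∑[ v < n ] ∑[ x < n ] b2n (v <ᶠ x ∧ b₀ ∧ b (suc v) ∧ b (suc x))
        ≡⟨ cong₂ _+_ (sum-replicate-zero (suc n)) (sum-cong-≗ λ v →
             trans (sum-cong-≗ λ x → cong b2n
                      (∧-Solver.solve 3 (λ l c r → l ⊕ (c ⊕ r) ⊜ c ⊕ (l ⊕ r)) refl (v <ᶠ x) b₀ _))
                   (count-∧ˡ b₀ (chain₂ (b ∘ suc) v))) ⟩
      ∑[ v < n ] (b2n b₀ * ∑[ x < n ] b2n (chain₂ (b ∘ suc) v x))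
        ≡⟨ *-distribˡ-sum (b2n b₀) (λ v → ∑[ x < n ] b2n (chain₂ (b ∘ suc) v x)) ⟨
      b2n b₀ * pairs (b ∘ suc) ∎
      where open ≡-Reasoning
    laterRow : ∀ u → ∑[ v < suc n ] ∑[ x < suc n ] b2n (chain₃ b (suc u) v x)
                   ≡ ∑[ v < n ] ∑[ x < n ] b2n (chain₃ (b ∘ suc) u v x)
    laterRow u = cong₂ _+_ (sum-replicate-zero (suc n)) (sum-cong-≗ λ v →
      cong (λ c → b2n c + ∑[ x < n ] b2n (chain₃ (b ∘ suc) u v x)) (∧-zeroʳ (u <ᶠ v)))

  pairs≡countC2 : ∀ {n} (b : Fin n → Bool) → pairs b ≡ count b C 2
  pairs≡countC2 {zero}  b = refl
  pairs≡countC2 {suc n} b = begin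
    pairs b                                       ≡⟨ pairs-suc b ⟩
    b2n (b zero) * count b′ + pairs b′            ≡⟨ cong₂ (λ m p → b2n (b zero) * m + p)
                                                          (sym (nC1≡n (count b′))) (pairs≡countC2 b′) ⟩
    b2n (b zero) * (count b′ C 1) + count b′ C 2  ≡⟨ [b+m]C[1+k]≡b*mCk+mC[1+k] (b zero) (count b′) 1 ⟨
    count b C 2                                   ∎
    where
    open ≡-Reasoning
    b′ = b ∘ suc

  triples≡countC3 : ∀ {n} (b : Fin n → Bool) → triples b ≡ count b C 3
  triples≡countC3 {zero}  b = refl
  triples≡countC3 {suc n} b = begin
    triples b                                     ≡⟨ triples-suc b ⟩
    b2n (b zero) * pairs b′ + triples b′          ≡⟨ cong₂ (λ p t → b2n (b zero) * p + t)
                                                          (pairs≡countC2 b′) (triples≡countC3 b′) ⟩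
    b2n (b zero) * (count b′ C 2) + count b′ C 3  ≡⟨ [b+m]C[1+k]≡b*mCk+mC[1+k] (b zero) (count b′) 2 ⟨
    count b C 3                                   ∎
    where
    open ≡-Reasoning
    b′ = b ∘ suc

  if-then-0≡b2n* : ∀ c m → (if c then m else 0) ≡ b2n c * m
  if-then-0≡b2n* false m = refl
  if-then-0≡b2n* true  m = sym (+-identityʳ m)

  -- Graphs

  module _ {n : ℕ} (G : Graph n) where

    adj⇒≢ : ∀ {u w} → adj G u w ≡ true → u ≢ w
    adj⇒≢ {u} e refl with trans (sym e) (irrefl G u)
    ... | ()

    wholeGraph : Subgraph G
    wholeGraph = record
      { vert = λ _ → true ; eadj = adj G ; esym = Graph.sym G ; eirr = irrefl G
      ; sub = λ _ _ e → e , refl , refl }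

    vcount-wholeGraph : vcount wholeGraph ≡ n
    vcount-wholeGraph = trans (Σ≡sum {n} (λ _ → 1)) (sum-ones n)

    orientedEdge : Fin n → Fin n → ℕ
    orientedEdge i j = if i <ᶠ j then b2n (adj G i j) else 0

    adj≡orientedEdge+orientedEdge : ∀ i j → b2n (adj G i j) ≡ orientedEdge i j + orientedEdge j i
    adj≡orientedEdge+orientedEdge i j
      with i <ᶠ j | <ᵇ-reflects-< (toℕ i) (toℕ j) | j <ᶠ i | <ᵇ-reflects-< (toℕ j) (toℕ i)
    ... | true  | ofʸ i<j | true  | ofʸ j<i = ⊥-elim (<-asym i<j j<i)
    ... | true  | _       | false | _       = sym (+-identityʳ _)
    ... | false | _       | true  | _       = cong b2n (Graph.sym G i j)
    ... | false | ofⁿ i≮j | false | ofⁿ j≮i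
      rewrite Fin.toℕ-injective (≤-antisym (≮⇒≥ j≮i) (≮⇒≥ i≮j)) = cong b2n (irrefl G j)

    sum-deg≡2*ecount : ∑[ v < n ] deg G v ≡ 2 * ecount wholeGraph
    sum-deg≡2*ecount = begin
      ∑[ i < n ] deg G i
        ≡⟨ sum-cong-≗ (λ i → Σ≡sum (λ j → b2n (adj G i j))) ⟩
      ∑[ i < n ] ∑[ j < n ] b2n (adj G i j)
        ≡⟨ sum-cong-≗ (λ i → sum-cong-≗ (adj≡orientedEdge+orientedEdge i)) ⟩
      ∑[ i < n ] ∑[ j < n ] (orientedEdge i j + orientedEdge j i)
        ≡⟨ trans (sum-cong-≗ λ i → ∑-distrib-+ (orientedEdge i) (λ j → orientedEdge j i))
                 (∑-distrib-+ (λ i → ∑[ j < n ] orientedEdge i j) (λ i → ∑[ j < n ] orientedEdge j i)) ⟩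
      e + ∑[ i < n ] ∑[ j < n ] orientedEdge j i
        ≡⟨ cong (e +_) (∑-comm (λ i j → orientedEdge j i)) ⟩
      e + e
        ≡⟨ cong (e +_) (+-identityʳ e) ⟨
      2 * e
        ≡⟨ cong (2 *_) ecount≡e ⟨
      2 * ecount wholeGraph ∎
      where
      open ≡-Reasoning
      e = ∑[ i < n ] ∑[ j < n ] orientedEdge i j
      ecount≡e : ecount wholeGraph ≡ e
      ecount≡e = trans (Σ≡sum (λ i → Σ[ n ] (orientedEdge i))) (sum-cong-≗ (λ i → Σ≡sum (orientedEdge i)))

    commonNbr₃ : Fin n → Fin n → Fin n → Fin n → Bool
    commonNbr₃ u v x w = adj G u w ∧ adj G v w ∧ adj G x w

    commonNbr₃⇒K33 : ∀ {u v x} → u ≢ v → v ≢ x → u ≢ x →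
                     3 ≤ count (commonNbr₃ u v x) → ContainsK33 G
    commonNbr₃⇒K33 {u} {v} {x} u≢v v≢x u≢x 3≤common = f , f-injective , f-complete
      where
      side : Fin 3 → Fin n
      side 0F = u
      side 1F = v
      side 2F = x
      side-injective : Injective _≡_ _≡_ side
      side-injective {0F} {0F} _ = refl
      side-injective {0F} {1F} p = ⊥-elim (u≢v p)
      side-injective {0F} {2F} p = ⊥-elim (u≢x p)
      side-injective {1F} {0F} p = ⊥-elim (u≢v (sym p))
      side-injective {1F} {1F} _ = refl
      side-injective {1F} {2F} p = ⊥-elim (v≢x p)
      side-injective {2F} {0F} p = ⊥-elim (u≢x (sym p))
      side-injective {2F} {1F} p = ⊥-elim (v≢x (sym p))
      side-injective {2F} {2F} _ = refl
      adjacent : ∀ i {w} → commonNbr₃ u v x w ≡ true → adj G (side i) w ≡ true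
      adjacent 0F {w} e = ∧-conicalˡ (adj G u w) _ e
      adjacent 1F {w} e = ∧-conicalˡ (adj G v w) (adj G x w) (∧-conicalʳ (adj G u w) _ e)
      adjacent 2F {w} e = ∧-conicalʳ (adj G v w) (adj G x w) (∧-conicalʳ (adj G u w) _ e)
      common = ≤count⇒injection (commonNbr₃ u v x) 3≤common
      f : Fin 3 ⊎ Fin 3 → Fin n
      f (inj₁ i) = side i
      f (inj₂ j) = proj₁ common j
      f-complete : ∀ i j → adj G (f (inj₁ i)) (f (inj₂ j)) ≡ true
      f-complete i j = adjacent i (proj₂ (proj₂ common) j)
      f-injective : Injective _≡_ _≡_ f
      f-injective {inj₁ i} {inj₁ j} p = cong inj₁ (side-injective p)
      f-injective {inj₁ i} {inj₂ j} p = ⊥-elim (adj⇒≢ (f-complete i j) p)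
      f-injective {inj₂ i} {inj₁ j} p = ⊥-elim (adj⇒≢ (f-complete j i) (sym p))
      f-injective {inj₂ i} {inj₂ j} p = cong inj₂ (proj₁ (proj₂ common) p)

    K33-free⇒commonNbr₃≤2 : ¬ ContainsK33 G → ∀ {u v x} → u ≢ v → v ≢ x → u ≢ x →
                            count (commonNbr₃ u v x) ≤ 2
    K33-free⇒commonNbr₃≤2 noK33 {u} {v} {x} u≢v v≢x u≢x with 3 ≤? count (commonNbr₃ u v x)
    ... | yes 3≤common = ⊥-elim (noK33 (commonNbr₃⇒K33 u≢v v≢x u≢x 3≤common))
    ... | no  3≰common = s≤s⁻¹ (≰⇒> 3≰common)

    chain₃⇒commonNbr₃≤2 : ¬ ContainsK33 G → ∀ S u v x → chain₃ S u v x ≡ true →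
                          count (commonNbr₃ u v x) ≤ 2
    chain₃⇒commonNbr₃≤2 noK33 S u v x e =
      K33-free⇒commonNbr₃≤2 noK33 (<⇒≢ u<v ∘ cong toℕ) (<⇒≢ v<x ∘ cong toℕ)
                                  (<⇒≢ (<-trans u<v v<x) ∘ cong toℕ)
      where
      u<v = <ᶠ⇒< (∧-conicalˡ (u <ᶠ v) _ e)
      v<x = <ᶠ⇒< (∧-conicalˡ (v <ᶠ x) _ (∧-conicalʳ (u <ᶠ v) _ e))

    chain₃*commonNbr₃≤2*chain₃ : ¬ ContainsK33 G → ∀ S u v x →
      b2n (chain₃ S u v x) * count (commonNbr₃ u v x) ≤ 2 * b2n (chain₃ S u v x)
    chain₃*commonNbr₃≤2*chain₃ noK33 S u v x with chain₃ S u v x in e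
    ... | false = z≤n
    ... | true  = subst (_≤ 2) (sym (+-identityʳ _)) (chain₃⇒commonNbr₃≤2 noK33 S u v x e)

    selectedNbr : (Fin n → Bool) → Fin n → Fin n → Bool
    selectedNbr S w u = S u ∧ adj G u w

    selectedCodegSum : (Fin n → Bool) → ℕ
    selectedCodegSum S = Σ[ n ] λ u → Σ[ n ] λ v → if chain₂ S u v then codeg G u v else 0

    chain₂-selectedNbr : ∀ S w u v →
                         chain₂ (selectedNbr S w) u v ≡ chain₂ S u v ∧ (adj G u w ∧ adj G v w)
    chain₂-selectedNbr S w u v =
      ∧-Solver.solve 5 (λ l su sv au av → l ⊕ ((su ⊕ au) ⊕ (sv ⊕ av)) ⊜ (l ⊕ (su ⊕ sv)) ⊕ (au ⊕ av))
        refl (u <ᶠ v) (S u) (S v) (adj G u w) (adj G v w)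

    chain₃-selectedNbr : ∀ S w u v x →
                         chain₃ (selectedNbr S w) u v x ≡ chain₃ S u v x ∧ commonNbr₃ u v x w
    chain₃-selectedNbr S w u v x =
      ∧-Solver.solve 8 (λ l₁ l₂ su sv sx au av ax →
          l₁ ⊕ (l₂ ⊕ ((su ⊕ au) ⊕ ((sv ⊕ av) ⊕ (sx ⊕ ax))))
        ⊜ (l₁ ⊕ (l₂ ⊕ (su ⊕ (sv ⊕ sx)))) ⊕ (au ⊕ (av ⊕ ax)))
        refl (u <ᶠ v) (v <ᶠ x) (S u) (S v) (S x) (adj G u w) (adj G v w) (adj G x w)

    codeg≡∑chain₂-selectedNbr : ∀ S u v → (if chain₂ S u v then codeg G u v else 0)
                                          ≡ ∑[ w < n ] b2n (chain₂ (selectedNbr S w) u v)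
    codeg≡∑chain₂-selectedNbr S u v = begin
      (if c then codeg G u v else 0)
        ≡⟨ if-then-0≡b2n* c (codeg G u v) ⟩
      b2n c * codeg G u v
        ≡⟨ cong (b2n c *_) (Σ≡sum (b2n ∘ common)) ⟩
      b2n c * count common
        ≡⟨ count-∧ˡ c common ⟨
      count (λ w → c ∧ common w)
        ≡⟨ sum-cong-≗ (λ w → cong b2n (chain₂-selectedNbr S w u v)) ⟨
      ∑[ w < n ] b2n (chain₂ (selectedNbr S w) u v) ∎
      where
      open ≡-Reasoning
      c = chain₂ S u v
      common = λ w → adj G u w ∧ adj G v w

    selectedCodegSum≡∑C2 : ∀ S → selectedCodegSum S ≡ ∑[ w < n ] (count (selectedNbr S w) C 2)
    selectedCodegSum≡∑C2 S = begin
      selectedCodegSum S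
        ≡⟨ trans (Σ≡sum (λ u → Σ[ n ] (term u))) (sum-cong-≗ λ u → Σ≡sum (term u)) ⟩
      ∑[ u < n ] ∑[ v < n ] term u v
        ≡⟨ sum-cong-≗ (λ u → sum-cong-≗ (codeg≡∑chain₂-selectedNbr S u)) ⟩
      ∑[ u < n ] ∑[ v < n ] ∑[ w < n ] b2n (chain₂ (selectedNbr S w) u v)
        ≡⟨ sum-cong-≗ (λ u → ∑-comm {n} {n} (λ v w → b2n (chain₂ (selectedNbr S w) u v))) ⟩
      ∑[ u < n ] ∑[ w < n ] ∑[ v < n ] b2n (chain₂ (selectedNbr S w) u v)
        ≡⟨ ∑-comm {n} {n} (λ u w → ∑[ v < n ] b2n (chain₂ (selectedNbr S w) u v)) ⟩
      ∑[ w < n ] pairs (selectedNbr S w)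
        ≡⟨ sum-cong-≗ (λ w → pairs≡countC2 (selectedNbr S w)) ⟩
      ∑[ w < n ] (count (selectedNbr S w) C 2) ∎
      where
      open ≡-Reasoning
      term : Fin n → Fin n → ℕ
      term u v = if chain₂ S u v then codeg G u v else 0

    ∑selectedNbrC3≤2*|S|C3 : ¬ ContainsK33 G → ∀ S →
                             ∑[ w < n ] (count (selectedNbr S w) C 3) ≤ 2 * (count S C 3)
    ∑selectedNbrC3≤2*|S|C3 noK33 S = begin
      ∑[ w < n ] (count (selectedNbr S w) C 3)
        ≡⟨ sum-cong-≗ (λ w → triples≡countC3 (selectedNbr S w)) ⟨
      ∑[ w < n ] ∑[ u < n ] ∑[ v < n ] ∑[ x < n ] t[ w ] u v x
        ≡⟨ trans (∑-comm {n} {n} λ w u → ∑[ v < n ] ∑[ x < n ] t[ w ] u v x)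
                 (sum-cong-≗ λ u → trans (∑-comm {n} {n} λ w v → ∑[ x < n ] t[ w ] u v x)
                                          (sum-cong-≗ λ v → ∑-comm {n} {n} λ w x → t[ w ] u v x)) ⟩
      ∑[ u < n ] ∑[ v < n ] ∑[ x < n ] ∑[ w < n ] t[ w ] u v x
        ≡⟨ sum-cong-≗ (λ u → sum-cong-≗ λ v → sum-cong-≗ λ x →
             trans (sum-cong-≗ λ w → cong b2n (chain₃-selectedNbr S w u v x))
                   (count-∧ˡ (chain₃ S u v x) (commonNbr₃ u v x))) ⟩
      ∑[ u < n ] ∑[ v < n ] ∑[ x < n ] (t u v x * count (commonNbr₃ u v x))
        ≤⟨ sum-mono-≤ (λ u → sum-mono-≤ λ v → sum-mono-≤ λ x → chain₃*commonNbr₃≤2*chain₃ noK33 S u v x) ⟩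
      ∑[ u < n ] ∑[ v < n ] ∑[ x < n ] (2 * t u v x)
        ≡⟨ trans (*-distribˡ-sum 2 λ u → ∑[ v < n ] ∑[ x < n ] t u v x)
                 (sum-cong-≗ λ u → trans (*-distribˡ-sum 2 λ v → ∑[ x < n ] t u v x)
                                          (sum-cong-≗ λ v → *-distribˡ-sum 2 (t u v))) ⟨
      2 * triples S
        ≡⟨ cong (2 *_) (triples≡countC3 S) ⟩
      2 * (count S C 3) ∎
      where
      open ≤-Reasoning
      t : Fin n → Fin n → Fin n → ℕ
      t u v x = b2n (chain₃ S u v x)
      t[_] : Fin n → Fin n → Fin n → Fin n → ℕ
      t[ w ] u v x = b2n (chain₃ (selectedNbr S w) u v x)

    selectedCodegSum≤n+4*|S|C3 : ¬ ContainsK33 G → ∀ S → selectedCodegSum S ≤ n + 4 * (count S C 3)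
    selectedCodegSum≤n+4*|S|C3 noK33 S = begin
      selectedCodegSum S                         ≡⟨ selectedCodegSum≡∑C2 S ⟩
      ∑[ w < n ] (d w C 2)                       ≤⟨ sum-mono-≤ (λ w → nC2≤1+2*nC3 (d w)) ⟩
      ∑[ w < n ] (1 + 2 * (d w C 3))             ≡⟨ ∑-distrib-+ (λ _ → 1) (λ w → 2 * (d w C 3)) ⟩
      ∑[ w < n ] 1 + ∑[ w < n ] (2 * (d w C 3))  ≡⟨ cong₂ _+_ (sym (sum-ones n))
                                                          (*-distribˡ-sum 2 (λ w → d w C 3)) ⟨
      n + 2 * ∑[ w < n ] (d w C 3)               ≤⟨ +-monoʳ-≤ n (*-monoʳ-≤ 2 (∑selectedNbrC3≤2*|S|C3 noK33 S)) ⟩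
      n + 2 * (2 * (count S C 3))                ≡⟨ cong (n +_) (*-assoc 2 2 (count S C 3)) ⟨
      n + 4 * (count S C 3)                      ∎
      where
      open ≤-Reasoning
      d : Fin n → ℕ
      d w = count (selectedNbr S w)

module RationalBounds where
  open Combinatorics
  open import Data.Nat as ℕ using (ℕ)
  open import Data.Nat.Combinatorics using (_C_)
  import Data.Integer as ℤ
  import Data.Integer.Properties as ℤ
  import Data.Nat.Coprimality as Coprime
  open import Data.Rational
    using (ℚ; mkℚ; 0ℚ; 1ℚ; _<_; _≤_; _*_; _+_; _÷_; _/_; >-nonZero; 1/_; *≤*; positive; nonNegative)
  import Data.Rational.Properties as ℚ
  open import Data.Rational.Solver using (module +-*-Solver)
  open import Relation.Nullary using (yes; no)

  ℕ→ℚ≡mkℚ : ∀ n → ℕ→ℚ n ≡ mkℚ (ℤ.+ n) 0 (Coprime.sym (Coprime.1-coprimeTo n))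
  ℕ→ℚ≡mkℚ n = ℚ.normalize-coprime (Coprime.sym (Coprime.1-coprimeTo n))

  ℕ→ℚ-homo-+ : ∀ m n → ℕ→ℚ (m ℕ.+ n) ≡ ℕ→ℚ m + ℕ→ℚ n
  ℕ→ℚ-homo-+ m n = trans (cong (_/ 1) numerator) (sym (cong₂ _+_ (ℕ→ℚ≡mkℚ m) (ℕ→ℚ≡mkℚ n)))
    where
    numerator : ℤ.+ (m ℕ.+ n) ≡ ℤ.+ m ℤ.* ℤ.+ 1 ℤ.+ ℤ.+ n ℤ.* ℤ.+ 1
    numerator = sym (cong₂ ℤ._+_ (ℤ.*-identityʳ (ℤ.+ m)) (ℤ.*-identityʳ (ℤ.+ n)))

  ℕ→ℚ-homo-* : ∀ m n → ℕ→ℚ (m ℕ.* n) ≡ ℕ→ℚ m * ℕ→ℚ n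
  ℕ→ℚ-homo-* m n = trans (cong (_/ 1) (ℤ.pos-* m n)) (sym (cong₂ _*_ (ℕ→ℚ≡mkℚ m) (ℕ→ℚ≡mkℚ n)))

  ℕ→ℚ-mono-≤ : ∀ {m n} → m ℕ.≤ n → ℕ→ℚ m ≤ ℕ→ℚ n
  ℕ→ℚ-mono-≤ {m} {n} m≤n = subst₂ _≤_ (sym (ℕ→ℚ≡mkℚ m)) (sym (ℕ→ℚ≡mkℚ n))
    (*≤* (subst₂ ℤ._≤_ (sym (ℤ.*-identityʳ (ℤ.+ m))) (sym (ℤ.*-identityʳ (ℤ.+ n))) (ℤ.+≤+ m≤n)))

  ℕ→ℚ-nonNeg : ∀ n → 0ℚ ≤ ℕ→ℚ n
  ℕ→ℚ-nonNeg n = ℕ→ℚ-mono-≤ (ℕ.z≤n {n})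

  *-nonNeg : ∀ {a b} → 0ℚ ≤ a → 0ℚ ≤ b → 0ℚ ≤ a * b
  *-nonNeg {a} {b} 0≤a 0≤b =
    ℚ.nonNegative⁻¹ _ {{ℚ.nonNeg*nonNeg⇒nonNeg a {{nonNegative 0≤a}} b {{nonNegative 0≤b}}}}

  *-mono-≤-nonNeg : ∀ {a b c d} → 0ℚ ≤ a → 0ℚ ≤ d → a ≤ b → c ≤ d → a * c ≤ b * d
  *-mono-≤-nonNeg {a} {b} {c} {d} 0≤a 0≤d a≤b c≤d = ℚ.≤-trans
    (ℚ.*-monoˡ-≤-nonNeg a {{nonNegative 0≤a}} c≤d) (ℚ.*-monoʳ-≤-nonNeg d {{nonNegative 0≤d}} a≤b)

  ^4-mono-≤ : ∀ {a b} → 0ℚ ≤ a → a ≤ b → a ^4 ≤ b ^4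
  ^4-mono-≤ {a} {b} 0≤a a≤b =
    *-mono-≤-nonNeg 0≤a³ 0≤b (*-mono-≤-nonNeg 0≤a² 0≤b (*-mono-≤-nonNeg 0≤a 0≤b a≤b a≤b) a≤b) a≤b
    where
    0≤b = ℚ.≤-trans 0≤a a≤b
    0≤a² = *-nonNeg 0≤a 0≤a
    0≤a³ = *-nonNeg 0≤a² 0≤a

  [2t]^4≡16*t^4 : ∀ t → (ℕ→ℚ 2 * t) ^4 ≡ ℕ→ℚ 16 * t ^4
  [2t]^4≡16*t^4 =
    solve 1 (λ t → two t :* two t :* two t :* two t := con (ℕ→ℚ 16) :* (t :* t :* t :* t)) refl
    where
    open +-*-Solver
    two = λ t → con (ℕ→ℚ 2) :* t

  *≤⇒≤÷ : ∀ {a b ε} (ε>0 : 0ℚ < ε) → a * ε ≤ b → a ≤ _÷_ b ε {{>-nonZero ε>0}}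
  *≤⇒≤÷ {a} {b} {ε} ε>0 aε≤b = ℚ.*-cancelʳ-≤-pos ε {{positive ε>0}} (begin
    a * ε           ≤⟨ aε≤b ⟩
    b               ≡⟨ ℚ.*-identityʳ b ⟨
    b * 1ℚ          ≡⟨ cong (b *_) (ℚ.*-inverseˡ ε) ⟨
    b * (1/ ε * ε)  ≡⟨ ℚ.*-assoc b (1/ ε) ε ⟨
    b * 1/ ε * ε    ∎)
    where
    open ℚ.≤-Reasoning
    instance
      ε≢0 = >-nonZero ε>0

  b2n*≤ : ∀ c m {q} → (c ≡ true → q ≤ ℕ→ℚ m) → ℕ→ℚ (b2n c) * q ≤ ℕ→ℚ m
  b2n*≤ false m {q} _   = ℚ.≤-trans (ℚ.≤-reflexive (ℚ.*-zeroˡ q)) (ℕ→ℚ-nonNeg m)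
  b2n*≤ true  m {q} q≤m = ℚ.≤-trans (ℚ.≤-reflexive (ℚ.*-identityˡ q)) (q≤m refl)

  count*≤sum : ∀ {n} (b : Fin n → Bool) (d : Fin n → ℕ) {q} →
               (∀ i → b i ≡ true → q ≤ ℕ→ℚ (d i)) → ℕ→ℚ (count b) * q ≤ ℕ→ℚ (sum d)
  count*≤sum {ℕ.zero}  b d {q} _   = ℚ.≤-reflexive (ℚ.*-zeroˡ q)
  count*≤sum {ℕ.suc n} b d {q} q≤d = begin
    ℕ→ℚ (b2n (b zero) ℕ.+ count (b ∘ suc)) * q
      ≡⟨ trans (cong (_* q) (ℕ→ℚ-homo-+ (b2n (b zero)) (count (b ∘ suc))))
               (ℚ.*-distribʳ-+ q (ℕ→ℚ (b2n (b zero))) (ℕ→ℚ (count (b ∘ suc)))) ⟩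
    ℕ→ℚ (b2n (b zero)) * q + ℕ→ℚ (count (b ∘ suc)) * q
      ≤⟨ ℚ.+-mono-≤ (b2n*≤ (b zero) (d zero) (q≤d zero)) (count*≤sum (b ∘ suc) (d ∘ suc) (q≤d ∘ suc)) ⟩
    ℕ→ℚ (d zero) + ℕ→ℚ (sum (d ∘ suc))
      ≡⟨ ℕ→ℚ-homo-+ (d zero) (sum (d ∘ suc)) ⟨
    ℕ→ℚ (sum d) ∎
    where open ℚ.≤-Reasoning

  nC3≤[n/2]^4 : ∀ k t → ℕ→ℚ k ≤ ℕ→ℚ 2 * t → ℕ→ℚ (k C 3) ≤ t ^4
  nC3≤[n/2]^4 k t k≤2t = ℚ.*-cancelˡ-≤-pos (ℕ→ℚ 16) (begin
    ℕ→ℚ 16 * ℕ→ℚ (k C 3)       ≡⟨ ℕ→ℚ-homo-* 16 (k C 3) ⟨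
    ℕ→ℚ (16 ℕ.* (k C 3))       ≤⟨ ℕ→ℚ-mono-≤ (16*nC3≤n*n*n*n k) ⟩
    ℕ→ℚ (k ℕ.* k ℕ.* k ℕ.* k)  ≡⟨ trans (ℕ→ℚ-homo-* (k ℕ.* k ℕ.* k) k) (cong (_* ℕ→ℚ k)
                                    (trans (ℕ→ℚ-homo-* (k ℕ.* k) k) (cong (_* ℕ→ℚ k) (ℕ→ℚ-homo-* k k)))) ⟩
    ℕ→ℚ k ^4                   ≤⟨ ^4-mono-≤ (ℕ→ℚ-nonNeg k) k≤2t ⟩
    (ℕ→ℚ 2 * t) ^4             ≡⟨ [2t]^4≡16*t^4 t ⟩
    ℕ→ℚ 16 * t ^4              ∎)
    where open ℚ.≤-Reasoning

  module _ {n : ℕ} (G : Graph n) where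

    inṼ⇒εn≤deg : ∀ ε v → inṼ G ε v ≡ true → ε * ℕ→ℚ n ≤ ℕ→ℚ (deg G v)
    inṼ⇒εn≤deg ε v _ with ε * ℕ→ℚ n ℚ.≤? ℕ→ℚ (deg G v)
    inṼ⇒εn≤deg ε v _  | yes εn≤deg = εn≤deg
    inṼ⇒εn≤deg ε v () | no _

    sum-deg≤2cn : ∀ {c} → (∀ (H : Subgraph G) → ℕ→ℚ (ecount H) ≤ c * ℕ→ℚ (vcount H)) →
                  ℕ→ℚ (sum (deg G)) ≤ ℕ→ℚ 2 * c * ℕ→ℚ n
    sum-deg≤2cn {c} sparse = begin
      ℕ→ℚ (sum (deg G))             ≡⟨ cong ℕ→ℚ (sum-deg≡2*ecount G) ⟩
      ℕ→ℚ (2 ℕ.* ecount W)          ≡⟨ ℕ→ℚ-homo-* 2 (ecount W) ⟩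
      ℕ→ℚ 2 * ℕ→ℚ (ecount W)        ≤⟨ ℚ.*-monoˡ-≤-nonNeg (ℕ→ℚ 2) (sparse W) ⟩
      ℕ→ℚ 2 * (c * ℕ→ℚ (vcount W))  ≡⟨ cong (λ m → ℕ→ℚ 2 * (c * ℕ→ℚ m)) (vcount-wholeGraph G) ⟩
      ℕ→ℚ 2 * (c * ℕ→ℚ n)           ≡⟨ ℚ.*-assoc (ℕ→ℚ 2) c (ℕ→ℚ n) ⟨
      ℕ→ℚ 2 * c * ℕ→ℚ n             ∎
      where
      open ℚ.≤-Reasoning
      W = wholeGraph G

  |Ṽ|*ε≤2c : ∀ {n} (G : Graph n) {c ε} → 0ℚ < c →
             (∀ (H : Subgraph G) → ℕ→ℚ (ecount H) ≤ c * ℕ→ℚ (vcount H)) →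
             ℕ→ℚ (count (inṼ G ε)) * ε ≤ ℕ→ℚ 2 * c
  |Ṽ|*ε≤2c {ℕ.zero} G {c} {ε} c>0 _ =
    ℚ.≤-trans (ℚ.≤-reflexive (ℚ.*-zeroˡ ε)) (ℚ.*-monoˡ-≤-nonNeg (ℕ→ℚ 2) (ℚ.<⇒≤ c>0))
  |Ṽ|*ε≤2c {ℕ.suc m} G {c} {ε} _ sparse = ℚ.*-cancelʳ-≤-pos N {{ℚ.normalize-pos (ℕ.suc m) 1}} (begin
    |Ṽ| * ε * N        ≡⟨ ℚ.*-assoc |Ṽ| ε N ⟩
    |Ṽ| * (ε * N)      ≤⟨ count*≤sum (inṼ G ε) (deg G) (inṼ⇒εn≤deg G ε) ⟩
    ℕ→ℚ (sum (deg G))  ≤⟨ sum-deg≤2cn G {c} sparse ⟩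
    ℕ→ℚ 2 * c * N      ∎)
    where
    open ℚ.≤-Reasoning
    N = ℕ→ℚ (ℕ.suc m)
    |Ṽ| = ℕ→ℚ (count (inṼ G ε))

  selectedCodegSum≤n+4t⁴ : ∀ {n} (G : Graph n) → ¬ ContainsK33 G → ∀ S t → ℕ→ℚ (count S) ≤ ℕ→ℚ 2 * t →
                           ℕ→ℚ (selectedCodegSum G S) ≤ ℕ→ℚ n + ℕ→ℚ 4 * t ^4
  selectedCodegSum≤n+4t⁴ {n} G noK33 S t |S|≤2t = begin
    ℕ→ℚ (selectedCodegSum G S)         ≤⟨ ℕ→ℚ-mono-≤ (selectedCodegSum≤n+4*|S|C3 G noK33 S) ⟩
    ℕ→ℚ (n ℕ.+ 4 ℕ.* (count S C 3))    ≡⟨ trans (ℕ→ℚ-homo-+ n _)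
                                                  (cong (ℕ→ℚ n +_) (ℕ→ℚ-homo-* 4 (count S C 3))) ⟩
    ℕ→ℚ n + ℕ→ℚ 4 * ℕ→ℚ (count S C 3)  ≤⟨ ℚ.+-monoʳ-≤ (ℕ→ℚ n)
                                            (ℚ.*-monoˡ-≤-nonNeg (ℕ→ℚ 4) (nC3≤[n/2]^4 (count S) t |S|≤2t)) ⟩
    ℕ→ℚ n + ℕ→ℚ 4 * t ^4               ∎
    where open ℚ.≤-Reasoning

open Combinatorics
open RationalBounds
open import Data.Nat using (ℕ)
open import Data.Rational using (ℚ; 0ℚ; _<_; _≤_; _*_; _+_; _÷_; >-nonZero)
import Data.Rational.Properties as ℚ

proposition2p6 : (C : ℚ) → 0ℚ < C → (n : ℕ) → (G : Graph n) → InClass C G →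
    (ε : ℚ) → (εpos : 0ℚ < ε) →
      (ℕ→ℚ (Ṽsize G ε) ≤ _÷_ (ℕ→ℚ 2 * C) ε {{>-nonZero εpos}})
      × (ℕ→ℚ (ṼpairCodegSum G ε) ≤ ℕ→ℚ n + ℕ→ℚ 4 * ((_÷_ C ε {{>-nonZero εpos}}) ^4))
proposition2p6 C C>0 n G (noK33 , sparse) ε ε>0 =
  subst (λ m → ℕ→ℚ m ≤ (ℕ→ℚ 2 * C) ÷ ε) (sym (Σ≡sum (b2n ∘ inṼ G ε))) |Ṽ|≤2C/ε ,
  selectedCodegSum≤n+4t⁴ G noK33 (inṼ G ε) (C ÷ ε)
    (ℚ.≤-trans |Ṽ|≤2C/ε (ℚ.≤-reflexive (ℚ.*-assoc (ℕ→ℚ 2) C _)))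
  where
  instance
    ε≢0 = >-nonZero ε>0
  |Ṽ|≤2C/ε : ℕ→ℚ (count (inṼ G ε)) ≤ (ℕ→ℚ 2 * C) ÷ ε
  |Ṽ|≤2C/ε = *≤⇒≤÷ ε>0 (|Ṽ|*ε≤2c G C>0 sparse)
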